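{- Let $\rho=(r,U)$ be a universally quantified rule, let $(\pi:L\to\bar L,\gamma:\bar L\rightharpoonup\bar R)$ be an instantiation of $\rho$, and let $u\in U$ with $(\pi,\gamma)\oplus u=(p'_u\circ\pi,\eta:\bar L_u\rightharpoonup\bar R_u)$. Then there are subgraph morphisms $\mu'_u:\bar L_u\rightharpoonup\bar L$ and $\mu''_u:\bar R_u\rightharpoonup\bar R$ such that $\gamma\circ\mu'_u=\mu''_u\circ\eta$.
   Context: A graph is $G=(V_G,E_G,c_G,l_G)$ over a finite label set $\Lambda$ with arity $\mathrm{ar}$: finite $V_G,E_G$, $c_G:E_G\to V_G^*$, $l_G:E_G\to\Lambda$, $|c_G(e)|=\mathrm{ar}(l_G(e))$; $e$ is incident to $v$ if $v$ occurs in $c_G(e)$. A morphism $\varphi:G\rightharpoonup G'$ is a pair of partial functions on nodes and edges such that whenever $\varphi_E(e)$ is defined, $\varphi_V$ is defined on all nodes of $c_G(e)$, labels are preserved and $\varphi_V(c_G(e))=c_{G'}(\varphi_E(e))$; total/injective/surjective if both components are. A subgraph morphism is a partial, injective and surjective morphism. Pushout of $\varphi:G_0\rightharpoonup G_1,\psi:G_0\rightharpoonup G_2$ in the category of graphs and partial morphisms: $G_3$ with $\psi':G_1\rightharpoonup G_3$, $\varphi':G_2\rightharpoonup G_3$, $\psi'\circ\varphi=\varphi'\circ\psi$, universal among such commuting pairs. Universally quantified rule $\rho=(r,U)$: $r:L\rightharpoonup R$, $U$ a finite set of $u=(p_u,q_u)$, $p_u:L\to L_u$ total injective, $q_u:L_u\rightharpoonup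 R_u$, with $q_u(p_u(x))$ defined and having exactly one $q_u$-preimage for each element $x$ of $L$; the set of nodes $v\in V_L$ such that some edge incident to $p_u(v)$ has no $p_u$-preimage is nonempty. Instantiations $(\pi:L\to\bar L,\gamma:\bar L\rightharpoonup\bar R)$: $(\mathrm{id}_L,r)$ is one; if $(\pi,\gamma)$ is one and $u\in U$, let $(\bar L_u,p'_u:\bar L\to\bar L_u,\pi':L_u\to\bar L_u)$ be the pushout of $\pi$ and $p_u$, $(\bar R_u,\sigma:\bar R\rightharpoonup\bar R_u,\tau:R_u\rightharpoonup\bar R_u)$ the pushout of $\gamma\circ\pi$ and $q_u\circ p_u$, and $\eta:\bar L_u\rightharpoonup\bar R_u$ the unique morphism with $\eta\circ p'_u=\sigma\circ\gamma$, $\eta\circ\pi'=\tau\circ q_u$; then $(\pi,\gamma)\oplus u:=(p'_u\circ\pi,\eta)$ is an instantiation. -}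

module Defs where

open import Level using (0ℓ)
open import Data.Nat using (ℕ)
open import Data.Fin using (Fin)
open import Data.List using (List; map; length)
open import Data.List.Membership.Propositional using (_∈_)
open import Data.Maybe using (Maybe; just; nothing; _>>=_)
open import Data.Product using (Σ; _×_; ∃; ∃-syntax; _,_)
open import Relation.Binary.PropositionalEquality using (_≡_; _≢_)

record Signature : Set where
  field
    nΛ : ℕ
    ar : Fin nΛ → ℕ

record Graph (S : Signature) : Set where
  open Signature S
  field
    nV    : ℕ
    nE    : ℕ
    conn  : Fin nE → List (Fin nV)
    lab   : Fin nE → Fin nΛ
    arity : ∀ e → length (conn e) ≡ ar (lab e)

open Graph public

module _ {S : Signature} where

  V : Graph S → Set
  V G = Fin (nV G)

  E : Graph S → Set
  E G = Fin (nE G)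

  record PMap (G H : Graph S) : Set where
    constructor pmap
    field
      mV : V G → Maybe (V H)
      mE : E G → Maybe (E H)
  open PMap public

  idₚ : {G : Graph S} → PMap G G
  idₚ = pmap just just

  infixr 9 _∘ₚ_
  _∘ₚ_ : {G H K : Graph S} → PMap H K → PMap G H → PMap G K
  ψ ∘ₚ φ = pmap (λ x → mV φ x >>= mV ψ) (λ e → mE φ e >>= mE ψ)

  infix 4 _≈ₚ_
  _≈ₚ_ : {G H : Graph S} → PMap G H → PMap G H → Set
  φ ≈ₚ ψ = (∀ v → mV φ v ≡ mV ψ v) × (∀ e → mE φ e ≡ mE ψ e)

  -- Morphism condition: if φ_E(e) = e' then labels agree, φ_V is defined
  -- on every node of c(e) and φ_V(c(e)) = c(e').
  IsMorphism : {G H : Graph S} → PMap G H → Set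
  IsMorphism {G} {H} φ =
    ∀ e e' → mE φ e ≡ just e' →
      (lab H e' ≡ lab G e) × (map (mV φ) (conn G e) ≡ map just (conn H e'))

  infix 4 _⇀_
  record _⇀_ (G H : Graph S) : Set where
    constructor mor
    field
      pm         : PMap G H
      isMorphism : IsMorphism pm
  open _⇀_ public

  IsTotal : {G H : Graph S} → PMap G H → Set
  IsTotal φ = (∀ v → ∃[ w ] mV φ v ≡ just w) × (∀ e → ∃[ f ] mE φ e ≡ just f)

  IsInjective : {G H : Graph S} → PMap G H → Set
  IsInjective φ =
    (∀ x y z → mV φ x ≡ just z → mV φ y ≡ just z → x ≡ y) ×
    (∀ x y z → mE φ x ≡ just z → mE φ y ≡ just z → x ≡ y)

  IsSurjective : {G H : Graph S} → PMap G H → Set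
  IsSurjective {H = H} φ =
    (∀ (w : V H) → ∃[ v ] mV φ v ≡ just w) × (∀ (f : E H) → ∃[ e ] mE φ e ≡ just f)

  IsSubgraphMorphism : {G H : Graph S} → G ⇀ H → Set
  IsSubgraphMorphism μ = IsInjective (pm μ) × IsSurjective (pm μ)

  record IsPushout {G0 G1 G2 G3 : Graph S} (φ : PMap G0 G1) (ψ : PMap G0 G2)
                   (ψ' : G1 ⇀ G3) (φ' : G2 ⇀ G3) : Set₁ where
    field
      commutes  : pm ψ' ∘ₚ φ ≈ₚ pm φ' ∘ₚ ψ
      universal : (G : Graph S) (a : G1 ⇀ G) (b : G2 ⇀ G) →
                  pm a ∘ₚ φ ≈ₚ pm b ∘ₚ ψ →
                  Σ (G3 ⇀ G) λ h →
                    (pm h ∘ₚ pm ψ' ≈ₚ pm a) × (pm h ∘ₚ pm φ' ≈ₚ pm b) ×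
                    ((h' : G3 ⇀ G) → pm h' ∘ₚ pm ψ' ≈ₚ pm a →
                       pm h' ∘ₚ pm φ' ≈ₚ pm b → pm h' ≈ₚ pm h)

  record QElem (L : Graph S) : Set where
    field
      Lu    : Graph S
      Ru    : Graph S
      p     : L ⇀ Lu
      q     : Lu ⇀ Ru
      p-total : IsTotal (pm p)
      p-inj   : IsInjective (pm p)
      -- q_u(p_u(x)) is defined and has exactly one q_u-preimage
      qp-V  : ∀ (v : V L) → Σ (V Ru) λ w →
                (mV (pm q ∘ₚ pm p) v ≡ just w) ×
                (∀ z → mV (pm q) z ≡ just w → mV (pm p) v ≡ just z)
      qp-E  : ∀ (e : E L) → Σ (E Ru) λ f →
                (mE (pm q ∘ₚ pm p) e ≡ just f) ×
                (∀ z → mE (pm q) z ≡ just f → mE (pm p) e ≡ just z)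
      nonempty : Σ (V L) λ v → Σ (E Lu) λ e →
                   (∃[ w ] (mV (pm p) v ≡ just w × w ∈ conn Lu e)) ×
                   (∀ e₀ → mE (pm p) e₀ ≢ just e)

  record Rule : Set where
    field
      L  : Graph S
      R  : Graph S
      r  : L ⇀ R
      nU : ℕ
      U  : Fin nU → QElem L

  -- The data of one step (π, γ) ⊕ u: the two pushouts and η.
  record StepData (ρ : Rule) {Lb Rb : Graph S} (π : PMap (Rule.L ρ) Lb)
                  (γ : PMap Lb Rb) (u : Fin (Rule.nU ρ)) : Set₁ where
    open QElem (Rule.U ρ u)
    field
      Lbu : Graph S
      p'  : Lb ⇀ Lbu
      π'  : Lu ⇀ Lbu
      po₁ : IsPushout π (pm p) p' π'
      Rbu : Graph S
      σ   : Rb ⇀ Rbu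
      τ   : Ru ⇀ Rbu
      po₂ : IsPushout (γ ∘ₚ π) (pm q ∘ₚ pm p) σ τ
      η   : Lbu ⇀ Rbu
      η-p' : pm η ∘ₚ pm p' ≈ₚ pm σ ∘ₚ γ
      η-π' : pm η ∘ₚ pm π' ≈ₚ pm τ ∘ₚ pm q

  open StepData public

  data Inst (ρ : Rule) : {Lb Rb : Graph S} → PMap (Rule.L ρ) Lb → PMap Lb Rb → Set₁ where
    base : Inst ρ idₚ (pm (Rule.r ρ))
    step : ∀ {Lb Rb} {π : PMap (Rule.L ρ) Lb} {γ : PMap Lb Rb} →
           Inst ρ π γ → (u : Fin (Rule.nU ρ)) → (d : StepData ρ π γ u) →
           Inst ρ (pm (p' d) ∘ₚ π) (pm (η d))

module Submission where

-- Both pushouts of a step (π, γ) ⊕ u are pushouts along total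
-- injective morphisms: p_u and q_u ∘ p_u.  A pushout of φ : G0 ⇀ G1 along a
-- total injective ψ : G0 → G2 retracts onto G1: the mediating morphism of
-- the pair (id, φ ∘ ψ⁻¹) is a subgraph morphism (the lemma retraction).
-- This yields μ'_u : L̄_u ⇀ L̄ and μ''_u : R̄_u ⇀ R̄.  The legs of a pushout
-- are jointly epimorphic, so γ ∘ μ'_u ≈ μ''_u ∘ η may be checked after
-- precomposing with p'_u and π'_u.  Along p'_u both sides reduce to γ;
-- along π'_u they reduce to the two sides of
--   γ ∘ (π ∘ p_u⁻¹) ≈ ((γ ∘ π) ∘ (q_u ∘ p_u)⁻¹) ∘ q_u     (transport-square),
-- which holds because q_u sends no element outside the image of p_u into
-- the image of q_u ∘ p_u (the unique-preimage condition on u).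

open import Defs
open import Level using (0ℓ)
open import Data.Fin using (Fin)
open import Data.Fin.Properties using (any?) renaming (_≟_ to _≟ᶠ_)
open import Data.Product using (Σ; _×_; ∃; _,_; proj₁; proj₂)
open import Data.Sum using (_⊎_; inj₁; inj₂)
open import Data.Empty using (⊥-elim)
open import Data.Maybe using (Maybe; just; nothing; _>>=_)
open import Data.Maybe.Properties using (just-injective; ≡-dec)
open import Data.List using (List; []; _∷_; map)
open import Data.List.Properties using (map-∘; ∷-injective)
open import Data.List.Membership.Propositional using (_∈_)
open import Data.List.Membership.Propositional.Properties using (∈-map⁺; ∈-map⁻)
open import Data.List.Relation.Unary.Any using (here; there)
open import Relation.Nullary using (¬_; Dec; yes; no)
open import Relation.Binary.Bundles using (Setoid)
open import Relation.Binary.PropositionalEquality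
import Relation.Binary.Reasoning.Setoid as SetoidReasoning

bind-just⁻¹ : {A B : Set} (m : Maybe A) (f : A → Maybe B) {z : B} → (m >>= f) ≡ just z →
              ∃ λ a → m ≡ just a × f a ≡ just z
bind-just⁻¹ (just a) f eq = a , refl , eq

bind-assoc : {A B C : Set} (m : Maybe A) (f : A → Maybe B) (g : B → Maybe C) →
             (m >>= λ a → f a >>= g) ≡ ((m >>= f) >>= g)
bind-assoc nothing  f g = refl
bind-assoc (just a) f g = refl

bind-identityʳ : {A : Set} (m : Maybe A) → (m >>= just) ≡ m
bind-identityʳ nothing  = refl
bind-identityʳ (just a) = refl

bind-cong : {A B : Set} (m : Maybe A) {f g : A → Maybe B} →
            (∀ a → f a ≡ g a) → (m >>= f) ≡ (m >>= g)
bind-cong nothing  f≗g = refl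
bind-cong (just a) f≗g = f≗g a

bind-fixes : {A : Set} (m : Maybe A) {f : A → Maybe A} →
             (∀ a → m ≡ just a → f a ≡ just a) → (m >>= f) ≡ m
bind-fixes nothing  fixes = refl
bind-fixes (just a) fixes = fixes a refl

keep-unless : {P A : Set} → Dec P → A → Maybe A
keep-unless (yes _) a = nothing
keep-unless (no _)  a = just a

keep-unless-no : {P A : Set} (d : Dec P) {a : A} → ¬ P → keep-unless d a ≡ just a
keep-unless-no (yes p) ¬p = ⊥-elim (¬p p)
keep-unless-no (no _)  ¬p = refl

keep-unless-yes : {P A : Set} (d : Dec P) {a : A} → P → keep-unless d a ≡ nothing
keep-unless-yes (yes _) p = refl
keep-unless-yes (no ¬p) p = ⊥-elim (¬p p)

keep-unless-just : {P A : Set} (d : Dec P) {a b : A} →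
                   keep-unless d a ≡ just b → ¬ P × a ≡ b
keep-unless-just (no ¬p) refl = ¬p , refl

module _ {S : Signature} where

  data Kind : Set where
    node edge : Kind

  El : Graph S → Kind → Set
  El G node = V G
  El G edge = E G

  app : {G H : Graph S} (k : Kind) → PMap G H → El G k → Maybe (El H k)
  app node φ = mV φ
  app edge φ = mE φ

  app-∘ : {G H K : Graph S} (k : Kind) (g : PMap H K) (f : PMap G H) (x : El G k) →
          app k (g ∘ₚ f) x ≡ (app k f x >>= app k g)
  app-∘ node g f x = refl
  app-∘ edge g f x = refl

  app-id : {G : Graph S} (k : Kind) (x : El G k) → app k idₚ x ≡ just x
  app-id node x = refl
  app-id edge x = refl

  app-∘-just : {G H K : Graph S} (k : Kind) (g : PMap H K) {f : PMap G H}
               {x : El G k} {y : El H k} →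
               app k f x ≡ just y → app k (g ∘ₚ f) x ≡ app k g y
  app-∘-just k g {f} {x} fx≡y = trans (app-∘ k g f x) (cong (_>>= app k g) fx≡y)

  -- Pointwise equality ≈ₚ packaged as a record: record types are injective,
  -- so Agda can infer the two compared maps from a proof of f ≋ g.
  infix 4 _≋_
  record _≋_ {G H : Graph S} (f g : PMap G H) : Set where
    constructor wrap
    field unwrap : f ≈ₚ g
  open _≋_ public

  ≋-at : {G H : Graph S} {f g : PMap G H} → f ≋ g → ∀ k x → app k f x ≡ app k g x
  ≋-at (wrap (f≗g , _)) node = f≗g
  ≋-at (wrap (_ , f≗g)) edge = f≗g

  ≋-intro : {G H : Graph S} {f g : PMap G H} → (∀ k x → app k f x ≡ app k g x) → f ≋ g
  ≋-intro f≗g = wrap (f≗g node , f≗g edge)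

  total-at : {G H : Graph S} {φ : PMap G H} → IsTotal φ →
             ∀ k x → ∃ λ y → app k φ x ≡ just y
  total-at φ-total node = proj₁ φ-total
  total-at φ-total edge = proj₂ φ-total

  injective-at : {G H : Graph S} {φ : PMap G H} → IsInjective φ →
                 ∀ k {x x' y} → app k φ x ≡ just y → app k φ x' ≡ just y → x ≡ x'
  injective-at φ-inj node = proj₁ φ-inj _ _ _
  injective-at φ-inj edge = proj₂ φ-inj _ _ _

  image? : {G H : Graph S} (k : Kind) (φ : PMap G H) (y : El H k) →
           Dec (∃ λ x → app k φ x ≡ just y)
  image? node φ y = any? (λ x → ≡-dec _≟ᶠ_ (mV φ x) (just y))
  image? edge φ y = any? (λ x → ≡-dec _≟ᶠ_ (mE φ x) (just y))

  module _ {G H : Graph S} where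
    ≋-refl : {f : PMap G H} → f ≋ f
    ≋-refl = ≋-intro (λ _ _ → refl)

    ≋-sym : {f g : PMap G H} → f ≋ g → g ≋ f
    ≋-sym f≋g = ≋-intro (λ k x → sym (≋-at f≋g k x))

    ≋-trans : {f g h : PMap G H} → f ≋ g → g ≋ h → f ≋ h
    ≋-trans f≋g g≋h = ≋-intro (λ k x → trans (≋-at f≋g k x) (≋-at g≋h k x))

  ≋-setoid : Graph S → Graph S → Setoid 0ℓ 0ℓ
  ≋-setoid G H = record
    { Carrier       = PMap G H
    ; _≈_           = _≋_
    ; isEquivalence = record { refl = ≋-refl ; sym = ≋-sym ; trans = ≋-trans }
    }

  module _ {G H K : Graph S} where

    ∘-congˡ : (g : PMap H K) {f f' : PMap G H} → f ≋ f' → g ∘ₚ f ≋ g ∘ₚ f'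
    ∘-congˡ g (wrap (f≗f'ⱽ , f≗f'ᴱ)) =
      wrap ((λ v → cong (_>>= mV g) (f≗f'ⱽ v)) , (λ e → cong (_>>= mE g) (f≗f'ᴱ e)))

    ∘-congʳ : {g g' : PMap H K} (f : PMap G H) → g ≋ g' → g ∘ₚ f ≋ g' ∘ₚ f
    ∘-congʳ f (wrap (g≗g'ⱽ , g≗g'ᴱ)) =
      wrap ((λ v → bind-cong (mV f v) g≗g'ⱽ) , (λ e → bind-cong (mE f e) g≗g'ᴱ))

  ∘-assoc : {G H K M : Graph S} (h : PMap K M) (g : PMap H K) (f : PMap G H) →
            (h ∘ₚ g) ∘ₚ f ≋ h ∘ₚ (g ∘ₚ f)
  ∘-assoc h g f = wrap ((λ v → bind-assoc (mV f v) (mV g) (mV h))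
                      , (λ e → bind-assoc (mE f e) (mE g) (mE h)))

  ∘-identityˡ : {G H : Graph S} (f : PMap G H) → idₚ ∘ₚ f ≋ f
  ∘-identityˡ f = wrap ((λ v → bind-identityʳ (mV f v)) , (λ e → bind-identityʳ (mE f e)))

  ∘-identityʳ : {G H : Graph S} (f : PMap G H) → f ∘ₚ idₚ ≋ f
  ∘-identityʳ f = ≋-refl

  idᵐ : {G : Graph S} → G ⇀ G
  idᵐ = mor idₚ (λ { e .e refl → refl , refl })

  ∘-isMorphism : {G H K : Graph S} {g : PMap H K} {f : PMap G H} →
                 IsMorphism g → IsMorphism f → IsMorphism (g ∘ₚ f)
  ∘-isMorphism {G} {H} {K} {g} {f} g-mor f-mor e e'' gfe≡e''
    with bind-just⁻¹ (mE f e) (mE g) gfe≡e''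
  ... | e' , fe≡e' , ge'≡e'' =
    trans (proj₁ (g-mor e' e'' ge'≡e'')) (proj₁ (f-mor e e' fe≡e')) ,
    (begin
      map (λ x → mV f x >>= mV g) (conn G e)               ≡⟨ map-∘ (conn G e) ⟩
      map (_>>= mV g) (map (mV f) (conn G e))               ≡⟨ cong (map (_>>= mV g)) (proj₂ (f-mor e e' fe≡e')) ⟩
      map (_>>= mV g) (map just (conn H e'))                ≡⟨ map-∘ (conn H e') ⟨
      map (mV g) (conn H e')                                ≡⟨ proj₂ (g-mor e' e'' ge'≡e'') ⟩
      map just (conn K e'')                                 ∎)
    where open ≡-Reasoning

  infixr 9 _∘ᵐ_
  _∘ᵐ_ : {G H K : Graph S} → H ⇀ K → G ⇀ H → G ⇀ K
  g ∘ᵐ f = mor (pm g ∘ₚ pm f) (∘-isMorphism {g = pm g} {f = pm f} (isMorphism g) (isMorphism f))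

  not-incident : {H G : Graph S} (χ : H ⇀ G) {x : V G} →
                 (∀ a → mV (pm χ) a ≢ just x) →
                 ∀ a e → mE (pm χ) a ≡ just e → ¬ (x ∈ conn G e)
  not-incident χ {x} x∉χ a e χa≡e x∈e
    with ∈-map⁻ (mV (pm χ)) (subst (just x ∈_) (sym (proj₂ (isMorphism χ a e χa≡e)))
                                   (∈-map⁺ just x∈e))
  ... | v , _ , x≡χv = x∉χ v (sym x≡χv)

  module Deletion (G : Graph S) where
    open import Data.List.Membership.DecPropositional (_≟ᶠ_ {nV G}) using (_∈?_)

    keep-others : (x : V G) (l : List (V G)) → ¬ (x ∈ l) →
                  map (λ v → keep-unless (v ≟ᶠ x) v) l ≡ map just l
    keep-others x []      x∉l = refl
    keep-others x (v ∷ l) x∉l =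
      cong₂ _∷_ (keep-unless-no (v ≟ᶠ x) (λ v≡x → x∉l (here (sym v≡x))))
                (keep-others x l (λ x∈l → x∉l (there x∈l)))

    delete-node : V G → G ⇀ G
    delete-node x = mor φ φ-mor
      where
      φ : PMap G G
      φ = pmap (λ v → keep-unless (v ≟ᶠ x) v) (λ e → keep-unless (x ∈? conn G e) e)
      φ-mor : IsMorphism φ
      φ-mor e e' φe≡e' with keep-unless-just (x ∈? conn G e) {e} φe≡e'
      ... | x∉e , refl = refl , keep-others x (conn G e) x∉e

    delete-edge : E G → G ⇀ G
    delete-edge x = mor φ φ-mor
      where
      φ : PMap G G
      φ = pmap just (λ e → keep-unless (e ≟ᶠ x) e)
      φ-mor : IsMorphism φ
      φ-mor e e' φe≡e' with keep-unless-just (e ≟ᶠ x) {e} φe≡e'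
      ... | _ , refl = refl , refl

    delete : (k : Kind) → El G k → G ⇀ G
    delete node = delete-node
    delete edge = delete-edge

    delete-self : (k : Kind) (x : El G k) → app k (pm (delete k x)) x ≡ nothing
    delete-self node x = keep-unless-yes (x ≟ᶠ x) refl
    delete-self edge x = keep-unless-yes (x ≟ᶠ x) refl

    delete-avoiding : {H : Graph S} (k : Kind) (x : El G k) (χ : H ⇀ G) →
                      (∀ a → app k (pm χ) a ≢ just x) →
                      pm (delete k x) ∘ₚ pm χ ≋ pm χ
    delete-avoiding node x χ x∉χ = wrap (
      (λ a → bind-fixes (mV (pm χ) a)
               (λ v χa≡v → keep-unless-no (v ≟ᶠ x) (λ v≡x → x∉χ a (trans χa≡v (cong just v≡x))))) ,
      (λ a → bind-fixes (mE (pm χ) a)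
               (λ e χa≡e → keep-unless-no (x ∈? conn G e) (not-incident χ x∉χ a e χa≡e))))
    delete-avoiding edge x χ x∉χ = wrap (
      (λ a → bind-identityʳ (mV (pm χ) a)) ,
      (λ a → bind-fixes (mE (pm χ) a)
               (λ e χa≡e → keep-unless-no (e ≟ᶠ x) (λ e≡x → x∉χ a (trans χa≡e (cong just e≡x))))))

  module Transport {G0 G1 G2 : Graph S} (φ : PMap G0 G1) (ψ : PMap G0 G2)
                   (ψ-inj : IsInjective ψ) where

    pull : ∀ {k y} → Dec (∃ λ c → app k ψ c ≡ just y) → Maybe (El G1 k)
    pull {k} (yes (c , _)) = app k φ c
    pull     (no _)        = nothing

    transport : PMap G2 G1
    transport = pmap (λ y → pull {node} (image? node ψ y)) (λ y → pull {edge} (image? edge ψ y))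

    app-transport : ∀ k y → app k transport y ≡ pull (image? k ψ y)
    app-transport node y = refl
    app-transport edge y = refl

    transport-image : ∀ k {c y} → app k ψ c ≡ just y → app k transport y ≡ app k φ c
    transport-image k {c} {y} ψc≡y = trans (app-transport k y) (on-image (image? k ψ y))
      where
      on-image : (d : Dec (∃ λ c → app k ψ c ≡ just y)) → pull d ≡ app k φ c
      on-image (yes (c' , ψc'≡y)) = cong (app k φ) (injective-at ψ-inj k ψc'≡y ψc≡y)
      on-image (no y∉ψ)           = ⊥-elim (y∉ψ (c , ψc≡y))

    transport-outside : ∀ k {y} → ¬ (∃ λ c → app k ψ c ≡ just y) →
                        app k transport y ≡ nothing
    transport-outside k {y} y∉ψ = trans (app-transport k y) (outside (image? k ψ y))
      where
      outside : (d : Dec (∃ λ c → app k ψ c ≡ just y)) → pull d ≡ nothing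
      outside (yes y∈ψ) = ⊥-elim (y∉ψ y∈ψ)
      outside (no _)    = refl

    transport-graph : ∀ k {y z} → app k transport y ≡ just z →
                      ∃ λ c → app k ψ c ≡ just y × app k φ c ≡ just z
    transport-graph k {y} {z} ty≡z = from-pull (image? k ψ y) (trans (sym (app-transport k y)) ty≡z)
      where
      from-pull : (d : Dec (∃ λ c → app k ψ c ≡ just y)) → pull d ≡ just z →
                  ∃ λ c → app k ψ c ≡ just y × app k φ c ≡ just z
      from-pull (yes (c , ψc≡y)) φc≡z = c , ψc≡y , φc≡z

    transport-section : IsTotal ψ → φ ≋ transport ∘ₚ ψ
    transport-section ψ-total = ≋-intro section-at
      where
      section-at : ∀ k c → app k φ c ≡ app k (transport ∘ₚ ψ) c
      section-at k c with total-at ψ-total k c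
      ... | y , ψc≡y = trans (sym (transport-image k ψc≡y)) (sym (app-∘-just k transport ψc≡y))

    transport-isMorphism : IsMorphism φ → IsMorphism ψ → IsMorphism transport
    transport-isMorphism φ-mor ψ-mor e z te≡z with transport-graph edge te≡z
    ... | c , ψc≡e , φc≡z =
      trans (proj₁ (φ-mor c z φc≡z)) (sym (proj₁ (ψ-mor c e ψc≡e))) ,
      trans (along-ψ (conn G0 c) (conn G2 e) (proj₂ (ψ-mor c e ψc≡e))) (proj₂ (φ-mor c z φc≡z))
      where
      along-ψ : ∀ cs ys → map (mV ψ) cs ≡ map just ys → map (mV transport) ys ≡ map (mV φ) cs
      along-ψ []       []       _  = refl
      along-ψ (c ∷ cs) (y ∷ ys) eq with ∷-injective eq
      ... | ψc≡y , rest = cong₂ _∷_ (transport-image node ψc≡y) (along-ψ cs ys rest)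

    transportᵐ : IsMorphism φ → IsMorphism ψ → G2 ⇀ G1
    transportᵐ φ-mor ψ-mor = mor transport (transport-isMorphism φ-mor ψ-mor)

  open Transport public using (transport)

  UniquePreimages : {G0 G2 G4 : Graph S} → PMap G2 G4 → PMap G0 G2 → Set
  UniquePreimages χ ψ = ∀ k {c z w} → app k (χ ∘ₚ ψ) c ≡ just w → app k χ z ≡ just w →
                        app k ψ c ≡ just z

  transport-square : {G0 G1 G2 G4 G5 : Graph S} (φ : PMap G0 G1) (g : PMap G1 G5)
                     {ψ : PMap G0 G2} {χ : PMap G2 G4}
                     (ψ-inj : IsInjective ψ) (χψ-inj : IsInjective (χ ∘ₚ ψ)) →
                     IsTotal (χ ∘ₚ ψ) → UniquePreimages χ ψ →
                     g ∘ₚ transport φ ψ ψ-inj ≋ transport (g ∘ₚ φ) (χ ∘ₚ ψ) χψ-inj ∘ₚ χ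
  transport-square φ g {ψ} {χ} ψ-inj χψ-inj χψ-total unique = ≋-intro square-at
    where
    module T₁ = Transport φ ψ ψ-inj
    module T₂ = Transport (g ∘ₚ φ) (χ ∘ₚ ψ) χψ-inj
    open ≡-Reasoning
    square-at : ∀ k b → app k (g ∘ₚ T₁.transport) b ≡ app k (T₂.transport ∘ₚ χ) b
    square-at k b with image? k ψ b
    ... | yes (c , ψc≡b) with total-at χψ-total k c
    ...   | w , χψc≡w = begin
      app k (g ∘ₚ T₁.transport) b          ≡⟨ app-∘ k g T₁.transport b ⟩
      (app k T₁.transport b >>= app k g)   ≡⟨ cong (_>>= app k g) (T₁.transport-image k ψc≡b) ⟩
      (app k φ c >>= app k g)              ≡⟨ app-∘ k g φ c ⟨
      app k (g ∘ₚ φ) c                     ≡⟨ T₂.transport-image k χψc≡w ⟨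
      app k T₂.transport w                 ≡⟨ app-∘-just k T₂.transport χb≡w ⟨
      app k (T₂.transport ∘ₚ χ) b          ∎
      where
      χb≡w : app k χ b ≡ just w
      χb≡w = trans (sym (app-∘-just k χ ψc≡b)) χψc≡w
    square-at k b | no b∉ψ = begin
      app k (g ∘ₚ T₁.transport) b          ≡⟨ app-∘ k g T₁.transport b ⟩
      (app k T₁.transport b >>= app k g)   ≡⟨ cong (_>>= app k g) (T₁.transport-outside k b∉ψ) ⟩
      nothing                              ≡⟨ outside (app k χ b) refl ⟩
      (app k χ b >>= app k T₂.transport)   ≡⟨ app-∘ k T₂.transport χ b ⟨
      app k (T₂.transport ∘ₚ χ) b          ∎
      where
      outside : (m : Maybe (El _ k)) → app k χ b ≡ m → nothing ≡ (m >>= app k T₂.transport)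
      outside nothing  _     = refl
      outside (just w) χb≡w  =
        sym (T₂.transport-outside k (λ { (c , χψc≡w) → b∉ψ (c , unique k χψc≡w χb≡w) }))

  record Retraction {G1 G2 G3 : Graph S} (ψ' : G1 ⇀ G3) (φ' : G2 ⇀ G3)
                    (b : PMap G2 G1) : Set where
    field
      μ        : G3 ⇀ G1
      subgraph : IsSubgraphMorphism μ
      on-ψ'    : pm μ ∘ₚ pm ψ' ≋ idₚ
      on-φ'    : pm μ ∘ₚ pm φ' ≋ b

  module PushoutFacts {G0 G1 G2 G3 : Graph S} {φ : PMap G0 G1} {ψ : PMap G0 G2}
                      {ψ' : G1 ⇀ G3} {φ' : G2 ⇀ G3} (po : IsPushout φ ψ ψ' φ') where
    open IsPushout po

    pushout-square : pm ψ' ∘ₚ φ ≋ pm φ' ∘ₚ ψ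
    pushout-square = wrap commutes

    jointly-epic : {G : Graph S} (f g : G3 ⇀ G) →
                   pm f ∘ₚ pm ψ' ≋ pm g ∘ₚ pm ψ' → pm f ∘ₚ pm φ' ≋ pm g ∘ₚ pm φ' →
                   pm f ≋ pm g
    jointly-epic {G} f g on-ψ' on-φ' = ≋-trans (unique f ≋-refl ≋-refl)
                                                (≋-sym (unique g (≋-sym on-ψ') (≋-sym on-φ')))
      where
      open SetoidReasoning (≋-setoid G0 G)
      square : pm (f ∘ᵐ ψ') ∘ₚ φ ≋ pm (f ∘ᵐ φ') ∘ₚ ψ
      square = begin
        (pm f ∘ₚ pm ψ') ∘ₚ φ  ≈⟨ ∘-assoc (pm f) (pm ψ') φ ⟩
        pm f ∘ₚ (pm ψ' ∘ₚ φ)  ≈⟨ ∘-congˡ (pm f) pushout-square ⟩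
        pm f ∘ₚ (pm φ' ∘ₚ ψ)  ≈⟨ ∘-assoc (pm f) (pm φ') ψ ⟨
        (pm f ∘ₚ pm φ') ∘ₚ ψ  ∎
      mediator = universal G (f ∘ᵐ ψ') (f ∘ᵐ φ') (unwrap square)
      unique : (h : G3 ⇀ G) → pm h ∘ₚ pm ψ' ≋ pm f ∘ₚ pm ψ' → pm h ∘ₚ pm φ' ≋ pm f ∘ₚ pm φ' →
               pm h ≋ pm (proj₁ mediator)
      unique h h-on-ψ' h-on-φ' =
        wrap (proj₂ (proj₂ (proj₂ mediator)) h (unwrap h-on-ψ') (unwrap h-on-φ'))

    -- The legs of a pushout are jointly surjective: an element in neither image
    -- would make its deletion morphism agree with the identity on both legs.
    jointly-surjective : ∀ k (x : El G3 k) →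
                         (∃ λ a → app k (pm ψ') a ≡ just x) ⊎ (∃ λ b → app k (pm φ') b ≡ just x)
    jointly-surjective k x with image? k (pm ψ') x | image? k (pm φ') x
    ... | yes x∈ψ' | _        = inj₁ x∈ψ'
    ... | no _     | yes x∈φ' = inj₂ x∈φ'
    ... | no x∉ψ'  | no x∉φ'  with trans (sym (Deletion.delete-self G3 k x))
                                         (trans (≋-at delete≈id k x) (app-id k x))
      where
      avoiding : {H : Graph S} (χ : H ⇀ G3) → ¬ (∃ λ a → app k (pm χ) a ≡ just x) →
                 pm (Deletion.delete G3 k x) ∘ₚ pm χ ≋ pm idᵐ ∘ₚ pm χ
      avoiding χ x∉χ = ≋-trans (Deletion.delete-avoiding G3 k x χ (λ a χa≡x → x∉χ (a , χa≡x)))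
                                (≋-sym (∘-identityˡ (pm χ)))
      delete≈id : pm (Deletion.delete G3 k x) ≋ pm idᵐ
      delete≈id = jointly-epic (Deletion.delete G3 k x) idᵐ (avoiding ψ' x∉ψ') (avoiding φ' x∉φ')
    ... | ()

    -- A pushout along a total injective morphism ψ retracts onto G1: the
    -- mediating morphism of (id, φ ∘ ψ⁻¹) is a subgraph morphism.
    retraction : (φ-mor : IsMorphism φ) (ψ-mor : IsMorphism ψ) →
                 IsTotal ψ → (ψ-inj : IsInjective ψ) →
                 Retraction ψ' φ' (transport φ ψ ψ-inj)
    retraction φ-mor ψ-mor ψ-total ψ-inj = record
      { μ        = μ
      ; subgraph = (injective node , injective edge) , (surjective node , surjective edge)
      ; on-ψ'    = μψ'≈id
      ; on-φ'    = μφ'≈b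
      }
      where
      open Transport φ ψ ψ-inj using (transportᵐ; transport-section; transport-graph)
      b = transportᵐ φ-mor ψ-mor
      square : pm idᵐ ∘ₚ φ ≋ pm b ∘ₚ ψ
      square = ≋-trans (∘-identityˡ φ) (transport-section ψ-total)
      mediator = universal G1 idᵐ b (unwrap square)
      μ = proj₁ mediator
      μψ'≈id = wrap (proj₁ (proj₂ mediator))
      μφ'≈b = wrap (proj₁ (proj₂ (proj₂ mediator)))

      inverse : ∀ k {x z} → app k (pm μ) x ≡ just z → app k (pm ψ') z ≡ just x
      inverse k {x} {z} μx≡z with jointly-surjective k x
      ... | inj₁ (a , ψ'a≡x) = subst (λ w → app k (pm ψ') w ≡ just x) a≡z ψ'a≡x
        where
        μx≡a : app k (pm μ) x ≡ just a
        μx≡a = trans (sym (app-∘-just k (pm μ) ψ'a≡x)) (trans (≋-at μψ'≈id k a) (app-id k a))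
        a≡z : a ≡ z
        a≡z = just-injective (trans (sym μx≡a) μx≡z)
      ... | inj₂ (y , φ'y≡x) with transport-graph k (trans (sym (≋-at μφ'≈b k y))
                                                           (trans (app-∘-just k (pm μ) φ'y≡x) μx≡z))
      ...   | c , ψc≡y , φc≡z = begin
        app k (pm ψ') z         ≡⟨ app-∘-just k (pm ψ') φc≡z ⟨
        app k (pm ψ' ∘ₚ φ) c    ≡⟨ ≋-at pushout-square k c ⟩
        app k (pm φ' ∘ₚ ψ) c    ≡⟨ app-∘-just k (pm φ') ψc≡y ⟩
        app k (pm φ') y         ≡⟨ φ'y≡x ⟩
        just x                  ∎
        where open ≡-Reasoning

      injective : ∀ k x y z → app k (pm μ) x ≡ just z → app k (pm μ) y ≡ just z → x ≡ y
      injective k x y z μx≡z μy≡z = just-injective (trans (sym (inverse k μx≡z)) (inverse k μy≡z))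

      surjective : ∀ k w → ∃ λ x → app k (pm μ) x ≡ just w
      surjective k w with bind-just⁻¹ (app k (pm ψ') w) (app k (pm μ))
                            (trans (sym (app-∘ k (pm μ) (pm ψ') w))
                                   (trans (≋-at μψ'≈id k w) (app-id k w)))
      ... | x , _ , μx≡w = x , μx≡w

  instantiation-morphisms : {ρ : Rule {S}} {Lb Rb : Graph S} {π : PMap (Rule.L ρ) Lb}
                            {γ : PMap Lb Rb} → Inst ρ π γ → IsMorphism π × IsMorphism γ
  instantiation-morphisms {ρ} base = isMorphism (idᵐ {Rule.L ρ}) , isMorphism (Rule.r ρ)
  instantiation-morphisms (step {π = π} inst u d) =
    ∘-isMorphism {g = pm (p' d)} {f = π} (isMorphism (p' d)) (proj₁ (instantiation-morphisms inst)) ,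
    isMorphism (η d)

  module QuantifiedElement {L : Graph S} (u : QElem L) where
    open QElem u

    qp-at : ∀ k c → Σ (El Ru k) λ w → (app k (pm q ∘ₚ pm p) c ≡ just w) ×
            (∀ z → app k (pm q) z ≡ just w → app k (pm p) c ≡ just z)
    qp-at node = qp-V
    qp-at edge = qp-E

    qp-total : IsTotal (pm q ∘ₚ pm p)
    qp-total = (λ v → proj₁ (qp-at node v) , proj₁ (proj₂ (qp-at node v)))
             , (λ e → proj₁ (qp-at edge e) , proj₁ (proj₂ (qp-at edge e)))

    qp-unique : UniquePreimages (pm q) (pm p)
    qp-unique k {c} {z} qpc≡w qz≡w with qp-at k c
    ... | w , qpc≡w' , preimages with trans (sym qpc≡w') qpc≡w
    ...   | refl = preimages z qz≡w

    qp-injective : IsInjective (pm q ∘ₚ pm p)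
    qp-injective = injective node , injective edge
      where
      injective : ∀ k c c' w → app k (pm q ∘ₚ pm p) c ≡ just w →
                  app k (pm q ∘ₚ pm p) c' ≡ just w → c ≡ c'
      injective k c c' w qpc≡w qpc'≡w
        with bind-just⁻¹ (app k (pm p) c') (app k (pm q))
                         (trans (sym (app-∘ k (pm q) (pm p) c')) qpc'≡w)
      ... | z , pc'≡z , qz≡w = injective-at p-inj k (qp-unique k qpc≡w qz≡w) pc'≡z

lemma8 : {S : Signature} (ρ : Rule {S}) {Lb Rb : Graph S}
         {π : PMap (Rule.L ρ) Lb} {γ : PMap Lb Rb} →
         Inst ρ π γ → (u : Fin (Rule.nU ρ)) → (d : StepData ρ π γ u) →
         Σ (Lbu d ⇀ Lb) λ μ' → Σ (Rbu d ⇀ Rb) λ μ'' →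
           IsSubgraphMorphism μ' × IsSubgraphMorphism μ'' ×
           (γ ∘ₚ pm μ' ≈ₚ pm μ'' ∘ₚ pm (η d))
lemma8 ρ {Lb} {Rb} {π} {γ} inst u d =
  R₁.μ , R₂.μ , R₁.subgraph , R₂.subgraph ,
  unwrap (PushoutFacts.jointly-epic (po₁ d) (γᵐ ∘ᵐ R₁.μ) (R₂.μ ∘ᵐ η d) on-p' on-π')
  where
  open QElem (Rule.U ρ u)
  open QuantifiedElement (Rule.U ρ u)
  πᵐ = mor π (proj₁ (instantiation-morphisms inst))
  γᵐ = mor γ (proj₂ (instantiation-morphisms inst))
  module R₁ = Retraction (PushoutFacts.retraction (po₁ d) (isMorphism πᵐ) (isMorphism p) p-total p-inj)
  module R₂ = Retraction (PushoutFacts.retraction (po₂ d) (isMorphism (γᵐ ∘ᵐ πᵐ))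
                            (isMorphism (q ∘ᵐ p)) qp-total qp-injective)
  -- Along p'_u both sides reduce to γ, as μ'_u ∘ p'_u and μ''_u ∘ σ are identities.
  on-p' : pm (γᵐ ∘ᵐ R₁.μ) ∘ₚ pm (p' d) ≋ pm (R₂.μ ∘ᵐ η d) ∘ₚ pm (p' d)
  on-p' = begin
    (γ ∘ₚ pm R₁.μ) ∘ₚ pm (p' d)          ≈⟨ ∘-assoc γ (pm R₁.μ) (pm (p' d)) ⟩
    γ ∘ₚ (pm R₁.μ ∘ₚ pm (p' d))          ≈⟨ ∘-congˡ γ R₁.on-ψ' ⟩
    γ ∘ₚ idₚ                              ≈⟨ ≋-trans (∘-identityʳ γ) (≋-sym (∘-identityˡ γ)) ⟩
    idₚ ∘ₚ γ                              ≈⟨ ∘-congʳ γ R₂.on-ψ' ⟨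
    (pm R₂.μ ∘ₚ pm (σ d)) ∘ₚ γ           ≈⟨ ∘-assoc (pm R₂.μ) (pm (σ d)) γ ⟩
    pm R₂.μ ∘ₚ (pm (σ d) ∘ₚ γ)           ≈⟨ ∘-congˡ (pm R₂.μ) (wrap (η-p' d)) ⟨
    pm R₂.μ ∘ₚ (pm (η d) ∘ₚ pm (p' d))   ≈⟨ ∘-assoc (pm R₂.μ) (pm (η d)) (pm (p' d)) ⟨
    (pm R₂.μ ∘ₚ pm (η d)) ∘ₚ pm (p' d)   ∎
    where open SetoidReasoning (≋-setoid Lb Rb)
  on-π' : pm (γᵐ ∘ᵐ R₁.μ) ∘ₚ pm (π' d) ≋ pm (R₂.μ ∘ᵐ η d) ∘ₚ pm (π' d)
  on-π' = begin
    (γ ∘ₚ pm R₁.μ) ∘ₚ pm (π' d)          ≈⟨ ∘-assoc γ (pm R₁.μ) (pm (π' d)) ⟩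
    γ ∘ₚ (pm R₁.μ ∘ₚ pm (π' d))          ≈⟨ ∘-congˡ γ R₁.on-φ' ⟩
    γ ∘ₚ transport π (pm p) p-inj         ≈⟨ transport-square π γ p-inj qp-injective qp-total qp-unique ⟩
    transport (γ ∘ₚ π) (pm q ∘ₚ pm p) qp-injective ∘ₚ pm q
                                          ≈⟨ ∘-congʳ (pm q) R₂.on-φ' ⟨
    (pm R₂.μ ∘ₚ pm (τ d)) ∘ₚ pm q        ≈⟨ ∘-assoc (pm R₂.μ) (pm (τ d)) (pm q) ⟩
    pm R₂.μ ∘ₚ (pm (τ d) ∘ₚ pm q)        ≈⟨ ∘-congˡ (pm R₂.μ) (wrap (η-π' d)) ⟨
    pm R₂.μ ∘ₚ (pm (η d) ∘ₚ pm (π' d))   ≈⟨ ∘-assoc (pm R₂.μ) (pm (η d)) (pm (π' d)) ⟨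
    (pm R₂.μ ∘ₚ pm (η d)) ∘ₚ pm (π' d)   ∎
    where open SetoidReasoning (≋-setoid Lu Rb)
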